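{- For every positive integer $n$, the vertices of the polytope $\mathrm{TSSCPP}(n)$ are exactly the $n\times n$ magog matrices.
   Context: An $n\times n$ magog matrix is an $n\times n$ matrix $A=(a_{ij})$ with entries in $\{0,1,-1\}$ such that all row sums and all column sums equal $1$, $0\le \sum_{i'=1}^{i}a_{i'j}\le 1$ for all $1\le i,j\le n$, $\sum_{j'=1}^{j}a_{ij'}\ge 0$ for all $1\le i,j\le n$, and for all $1\le i\le n-2$, $1\le j\le n-2$, $$\sum_{j'=1}^{j}a_{i+1,j'}+\sum_{i'=1}^{i+1}a_{i',j+1}-\sum_{i'=1}^{i}a_{i'j}\ge 0.$$ $\mathrm{TSSCPP}(n)\subseteq\mathbb{R}^{n\times n}$ is the convex hull of all $n\times n$ magog matrices.
   Formalization: The polytope TSSCPP(n) is taken in ℚ^(n×n) rather than $\mathbb{R}^{n\times n}$, with rational convex-combination coefficients, and the vertex test ranges over rational points and rational weights only. -}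

module Defs where

open import Data.Nat as ℕ using (ℕ; zero; suc; _<?_; _∸_)
open import Data.Fin using (Fin; fromℕ<)
open import Data.Integer as ℤ using (ℤ; +_; -[1+_])
open import Data.Rational as ℚ using (ℚ; 0ℚ; 1ℚ; _/_)
open import Data.Product using (_×_; _,_; Σ; ∃)
open import Data.Sum using (_⊎_)
open import Data.List using (List; []; _∷_; foldr; map)
open import Data.List.Relation.Unary.All using (All)
open import Relation.Binary.PropositionalEquality using (_≡_)
open import Relation.Nullary using (yes; no)

ZMatrix : ℕ → Set
ZMatrix n = Fin n → Fin n → ℤ

-- entry a_{ij} with 1-based indices i j; 0 outside the range 1..n
ent : {n : ℕ} → ZMatrix n → ℕ → ℕ → ℤ
ent A zero    _       = + 0
ent A (suc i) zero    = + 0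
ent {n} A (suc i) (suc j) with i <? n | j <? n
... | yes p | yes q = A (fromℕ< p) (fromℕ< q)
... | _     | _     = + 0

S : ℕ → (ℕ → ℤ) → ℤ
S zero    f = + 0
S (suc k) f = S k f ℤ.+ f (suc k)

-- the magog conditions (indices 1-based as in the paper)
record IsMagog {n : ℕ} (A : ZMatrix n) : Set where
  field
    entries    : ∀ i j → (A i j ≡ + 0) ⊎ (A i j ≡ + 1) ⊎ (A i j ≡ -[1+ 0 ])
    rowSums    : ∀ i → 1 ℕ.≤ i → i ℕ.≤ n → S n (λ j → ent A i j) ≡ + 1
    colSums    : ∀ j → 1 ℕ.≤ j → j ℕ.≤ n → S n (λ i → ent A i j) ≡ + 1
    colPartial : ∀ i j → 1 ℕ.≤ i → i ℕ.≤ n → 1 ℕ.≤ j → j ℕ.≤ n →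
                 (+ 0 ℤ.≤ S i (λ i' → ent A i' j)) × (S i (λ i' → ent A i' j) ℤ.≤ + 1)
    rowPartial : ∀ i j → 1 ℕ.≤ i → i ℕ.≤ n → 1 ℕ.≤ j → j ℕ.≤ n →
                 + 0 ℤ.≤ S j (λ j' → ent A i j')
    extra      : ∀ i j → 1 ℕ.≤ i → i ℕ.≤ n ∸ 2 → 1 ℕ.≤ j → j ℕ.≤ n ∸ 2 →
                 + 0 ℤ.≤ (S j (λ j' → ent A (suc i) j')
                          ℤ.+ S (suc i) (λ i' → ent A i' (suc j))
                          ℤ.- S i (λ i' → ent A i' j))

-- rational matrices, the ambient space (rational stand-in for ℝ^{n×n})
QMatrix : ℕ → Set
QMatrix n = Fin n → Fin n → ℚ

embed : {n : ℕ} → ZMatrix n → QMatrix n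
embed A i j = A i j / 1

_+ᴹ_ : {n : ℕ} → QMatrix n → QMatrix n → QMatrix n
(X +ᴹ Y) i j = X i j ℚ.+ Y i j

_·ᴹ_ : {n : ℕ} → ℚ → QMatrix n → QMatrix n
(t ·ᴹ X) i j = t ℚ.* X i j

zeroᴹ : {n : ℕ} → QMatrix n
zeroᴹ i j = 0ℚ

-- a finite convex combination: list of (coefficient, magog matrix)
Term : ℕ → Set
Term n = ℚ × Σ (ZMatrix n) IsMagog

coeffSum : {n : ℕ} → List (Term n) → ℚ
coeffSum = foldr (λ { (t , _) s → t ℚ.+ s }) 0ℚ

combo : {n : ℕ} → List (Term n) → QMatrix n
combo = foldr (λ { (t , (A , _)) X → (t ·ᴹ embed A) +ᴹ X }) zeroᴹ

NonNegCoeff : {n : ℕ} → Term n → Set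
NonNegCoeff (t , _) = 0ℚ ℚ.≤ t

InTSSCPP : (n : ℕ) → QMatrix n → Set
InTSSCPP n X = ∃ λ (cs : List (Term n)) →
  All NonNegCoeff cs × (coeffSum cs ≡ 1ℚ) × (∀ i j → X i j ≡ combo cs i j)

IsVertex : (n : ℕ) → QMatrix n → Set
IsVertex n X = InTSSCPP n X ×
  (∀ (Y Z : QMatrix n) (t : ℚ) → InTSSCPP n Y → InTSSCPP n Z →
     0ℚ ℚ.< t → t ℚ.< 1ℚ →
     (∀ i j → X i j ≡ ((t ·ᴹ Y) +ᴹ ((1ℚ ℚ.- t) ·ᴹ Z)) i j) →
     ∀ i j → Y i j ≡ Z i j)

IsMagogQ : (n : ℕ) → QMatrix n → Set
IsMagogQ n X = ∃ λ (A : ZMatrix n) → IsMagog A × (∀ i j → X i j ≡ embed A i j)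

{-# OPTIONS --safe #-}
-- The column partial sums of a magog matrix are 0 or 1, and therefore those of every point
-- of TSSCPP(n) lie in [0,1]. A number in {0,1} is a proper convex combination of two numbers
-- in [0,1] only if both of them equal it; so when a magog matrix is t Y + (1 - t) Z with
-- Y, Z in TSSCPP(n), the matrices Y and Z have the same column partial sums, hence the same
-- entries. Conversely, write a vertex X as a convex combination of magog matrices whose first
-- coefficient t is positive. If t = 1 then X is that magog matrix A; otherwise
-- X = t A + (1 - t) Z with Z the renormalised rest of the combination, and extremality
-- gives A = Z, so again X = A.
module Submission where

open import Defs
open import Level using (0ℓ)
open import Data.Nat as ℕ using (ℕ; zero; suc; _<?_; z≤n; s≤s)
open import Data.Fin using (Fin; fromℕ<; toℕ)
import Data.Nat.Properties as ℕP
import Data.Fin.Properties as FinP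
open import Data.Integer as ℤ using (ℤ; -[1+_])
import Data.Integer.Properties as ℤP
open import Data.Rational using (ℚ; 0ℚ; 1ℚ; _/_; toℚᵘ; 1/_; _+_; _*_; _-_; -_; _≤_; _<_)
import Data.Rational as ℚ
import Data.Rational.Properties as ℚP
import Data.Rational.Unnormalised as ℚᵘ
import Data.Rational.Unnormalised.Properties as ℚᵘP
open import Data.Product using (_×_; _,_; Σ-syntax)
open import Data.Sum as Sum using (_⊎_; inj₁; inj₂)
open import Data.List using (List; []; _∷_; map)
open import Data.List.Relation.Unary.All using (All; []; _∷_)
open import Data.List.Relation.Unary.All.Properties using (gmap⁺)
open import Data.Empty using (⊥-elim)
open import Relation.Binary.PropositionalEquality
open import Relation.Nullary using (yes; no)
open import Relation.Nullary.Decidable using (dec⇒maybe)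
open import Algebra.Properties.Group ℚP.+-0-group using () renaming (∙-cancelˡ to +-cancelˡ)
open import Tactic.RingSolver using (solve-∀)
open import Tactic.RingSolver.Core.AlmostCommutativeRing
  using (AlmostCommutativeRing; fromCommutativeRing)

ℚ-almostCommutativeRing : AlmostCommutativeRing 0ℓ 0ℓ
ℚ-almostCommutativeRing =
  fromCommutativeRing ℚP.+-*-commutativeRing (λ x → dec⇒maybe (0ℚ ℚP.≟ x))

_∈[0,_] : ℚ → ℚ → Set
p ∈[0, u ] = 0ℚ ≤ p × p ≤ u

Bit : ℚ → Set
Bit p = p ≡ 0ℚ ⊎ p ≡ 1ℚ

Bit⇒∈[0,1] : ∀ {p} → Bit p → p ∈[0, 1ℚ ]
Bit⇒∈[0,1] (inj₁ refl) = ℚP.≤-refl , ℚP.nonNegative⁻¹ 1ℚ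
Bit⇒∈[0,1] (inj₂ refl) = ℚP.nonNegative⁻¹ 1ℚ , ℚP.≤-refl

p+q≡0⇒p≡0 : ∀ {p q} → 0ℚ ≤ p → 0ℚ ≤ q → p + q ≡ 0ℚ → p ≡ 0ℚ
p+q≡0⇒p≡0 {p} 0≤p 0≤q p+q≡0 =
  ℚP.≤-antisym (subst₂ _≤_ (ℚP.+-identityʳ p) p+q≡0 (ℚP.+-monoʳ-≤ p 0≤q)) 0≤p

p+q≡0⇒q≡0 : ∀ {p q} → 0ℚ ≤ p → 0ℚ ≤ q → p + q ≡ 0ℚ → q ≡ 0ℚ
p+q≡0⇒q≡0 {p} {q} 0≤p 0≤q p+q≡0 = p+q≡0⇒p≡0 0≤q 0≤p (trans (ℚP.+-comm q p) p+q≡0)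

r*p≡0⇒p≡0 : ∀ {r p} → 0ℚ < r → r * p ≡ 0ℚ → p ≡ 0ℚ
r*p≡0⇒p≡0 {r} {p} 0<r r*p≡0 = ℚP.≤-antisym
  (ℚP.*-cancelˡ-≤-pos r (ℚP.≤-reflexive (trans r*p≡0 (sym (ℚP.*-zeroʳ r)))))
  (ℚP.*-cancelˡ-≤-pos r (ℚP.≤-reflexive (trans (ℚP.*-zeroʳ r) (sym r*p≡0))))
  where instance _ = ℚ.positive 0<r

*-nonNeg : ∀ {p q} → 0ℚ ≤ p → 0ℚ ≤ q → 0ℚ ≤ p * q
*-nonNeg {p} {q} 0≤p 0≤q =
  ℚP.nonNegative⁻¹ (p * q)
    {{ℚP.nonNeg*nonNeg⇒nonNeg p {{ℚ.nonNegative 0≤p}} q {{ℚ.nonNegative 0≤q}}}}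

*-∈[0,t] : ∀ {t p} → 0ℚ ≤ t → p ∈[0, 1ℚ ] → (t * p) ∈[0, t ]
*-∈[0,t] {t} 0≤t (0≤p , p≤1) =
  *-nonNeg 0≤t 0≤p ,
  subst (t * _ ≤_) (ℚP.*-identityʳ t) (ℚP.*-monoˡ-≤-nonNeg t {{ℚ.nonNegative 0≤t}} p≤1)

+-nonNeg : ∀ {p q} → 0ℚ ≤ p → 0ℚ ≤ q → 0ℚ ≤ p + q
+-nonNeg {p} {q} 0≤p 0≤q = subst (_≤ p + q) (ℚP.+-identityʳ 0ℚ) (ℚP.+-mono-≤ 0≤p 0≤q)

+-∈[0,u+v] : ∀ {p q u v} → p ∈[0, u ] → q ∈[0, v ] → (p + q) ∈[0, u + v ]
+-∈[0,u+v] (0≤p , p≤u) (0≤q , q≤v) = +-nonNeg 0≤p 0≤q , ℚP.+-mono-≤ p≤u q≤v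

0≤1-p : ∀ {p} → p ≤ 1ℚ → 0ℚ ≤ 1ℚ - p
0≤1-p {p} p≤1 = subst (_≤ 1ℚ - p) (ℚP.+-inverseʳ p) (ℚP.+-monoˡ-≤ (- p) p≤1)

0<1-p : ∀ {p} → p < 1ℚ → 0ℚ < 1ℚ - p
0<1-p {p} p<1 = subst (_< 1ℚ - p) (ℚP.+-inverseʳ p) (ℚP.+-monoˡ-< (- p) p<1)

convex≡0⇒≡0 : ∀ {t p q} → 0ℚ < t → t < 1ℚ → 0ℚ ≤ p → 0ℚ ≤ q →
  t * p + (1ℚ - t) * q ≡ 0ℚ → p ≡ 0ℚ × q ≡ 0ℚ
convex≡0⇒≡0 0<t t<1 0≤p 0≤q sum≡0 =
  r*p≡0⇒p≡0 0<t (p+q≡0⇒p≡0 0≤tp 0≤[1-t]q sum≡0) ,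
  r*p≡0⇒p≡0 (0<1-p t<1) (p+q≡0⇒q≡0 0≤tp 0≤[1-t]q sum≡0)
  where
  0≤tp = *-nonNeg (ℚP.<⇒≤ 0<t) 0≤p
  0≤[1-t]q = *-nonNeg (ℚP.<⇒≤ (0<1-p t<1)) 0≤q

-- Reflecting p ↦ 1 - p reduces this to the case of 0.
convex≡1⇒≡1 : ∀ {t p q} → 0ℚ < t → t < 1ℚ → p ≤ 1ℚ → q ≤ 1ℚ →
  t * p + (1ℚ - t) * q ≡ 1ℚ → p ≡ 1ℚ × q ≡ 1ℚ
convex≡1⇒≡1 {t} {p} {q} 0<t t<1 p≤1 q≤1 sum≡1 =
  let (1-p≡0 , 1-q≡0) = convex≡0⇒≡0 0<t t<1 (0≤1-p p≤1) (0≤1-p q≤1) reflected≡0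
  in 1-x≡0⇒x≡1 p 1-p≡0 , 1-x≡0⇒x≡1 q 1-q≡0
  where
  reflect : ∀ t p q → t * (1ℚ - p) + (1ℚ - t) * (1ℚ - q) ≡ 1ℚ - (t * p + (1ℚ - t) * q)
  reflect = solve-∀ ℚ-almostCommutativeRing
  reflected≡0 : t * (1ℚ - p) + (1ℚ - t) * (1ℚ - q) ≡ 0ℚ
  reflected≡0 = trans (reflect t p q) (trans (cong (λ x → 1ℚ - x) sum≡1) (ℚP.+-inverseʳ 1ℚ))
  involutive : ∀ x → 1ℚ - (1ℚ - x) ≡ x
  involutive = solve-∀ ℚ-almostCommutativeRing
  1-x≡0⇒x≡1 : ∀ x → 1ℚ - x ≡ 0ℚ → x ≡ 1ℚ
  1-x≡0⇒x≡1 x 1-x≡0 =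
    trans (sym (involutive x)) (trans (cong (λ x → 1ℚ - x) 1-x≡0) (ℚP.+-identityʳ 1ℚ))

Bit-convex⇒≡ : ∀ {x t p q} → Bit x → 0ℚ < t → t < 1ℚ → p ∈[0, 1ℚ ] → q ∈[0, 1ℚ ] →
  x ≡ t * p + (1ℚ - t) * q → p ≡ q
Bit-convex⇒≡ (inj₁ refl) 0<t t<1 (0≤p , _) (0≤q , _) x≡ =
  let (p≡0 , q≡0) = convex≡0⇒≡0 0<t t<1 0≤p 0≤q (sym x≡) in trans p≡0 (sym q≡0)
Bit-convex⇒≡ (inj₂ refl) 0<t t<1 (_ , p≤1) (_ , q≤1) x≡ =
  let (p≡1 , q≡1) = convex≡1⇒≡1 0<t t<1 p≤1 q≤1 (sym x≡) in trans p≡1 (sym q≡1)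

/1-homo-+ : ∀ a b → (a ℤ.+ b) / 1 ≡ a / 1 + b / 1
/1-homo-+ a b = ℚP.toℚᵘ-injective (begin
  toℚᵘ ((a ℤ.+ b) / 1)                 ≈⟨ ℚP.toℚᵘ-fromℚᵘ (ℚᵘ.mkℚᵘ (a ℤ.+ b) 0) ⟩
  ℚᵘ.mkℚᵘ (a ℤ.+ b) 0                  ≈⟨ ℚᵘP.≃-reflexive (cong (λ c → ℚᵘ.mkℚᵘ c 0)
                                            (cong₂ ℤ._+_ (ℤP.*-identityʳ a) (ℤP.*-identityʳ b))) ⟨
  ℚᵘ.mkℚᵘ a 0 ℚᵘ.+ ℚᵘ.mkℚᵘ b 0        ≈⟨ ℚᵘP.+-cong (ℚᵘP.≃-sym (ℚP.toℚᵘ-fromℚᵘ (ℚᵘ.mkℚᵘ a 0)))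
                                                      (ℚᵘP.≃-sym (ℚP.toℚᵘ-fromℚᵘ (ℚᵘ.mkℚᵘ b 0))) ⟩
  toℚᵘ (a / 1) ℚᵘ.+ toℚᵘ (b / 1)      ≈⟨ ℚᵘP.≃-sym (ℚP.toℚᵘ-homo-+ (a / 1) (b / 1)) ⟩
  toℚᵘ (a / 1 + b / 1)                 ∎)
  where open ℚᵘP.≃-Reasoning

-- The rational counterpart of ent: 1-based indices, junk value 0 outside 1..n.
entℚ : {n : ℕ} → QMatrix n → ℕ → ℕ → ℚ
entℚ M zero    _       = 0ℚ
entℚ M (suc i) zero    = 0ℚ
entℚ {n} M (suc i) (suc j) with i <? n | j <? n
... | yes p | yes q = M (fromℕ< p) (fromℕ< q)
... | _     | _     = 0ℚ

entℚ-map₂ : {n : ℕ} (g : ℚ → ℚ → ℚ) → g 0ℚ 0ℚ ≡ 0ℚ → (M N : QMatrix n) → ∀ i j →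
  entℚ (λ a b → g (M a b) (N a b)) i j ≡ g (entℚ M i j) (entℚ N i j)
entℚ-map₂ g g00≡0 M N zero    j       = sym g00≡0
entℚ-map₂ g g00≡0 M N (suc i) zero    = sym g00≡0
entℚ-map₂ {n} g g00≡0 M N (suc i) (suc j) with i <? n | j <? n
... | yes _ | yes _ = refl
... | yes _ | no _  = sym g00≡0
... | no _  | _     = sym g00≡0

entℚ-cong : {n : ℕ} {M N : QMatrix n} → (∀ a b → M a b ≡ N a b) → ∀ i j → entℚ M i j ≡ entℚ N i j
entℚ-cong M≗N zero    j       = refl
entℚ-cong M≗N (suc i) zero    = refl
entℚ-cong {n} M≗N (suc i) (suc j) with i <? n | j <? n
... | yes _ | yes _ = M≗N _ _
... | yes _ | no _  = refl
... | no _  | _     = refl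

entℚ-embed : {n : ℕ} (A : ZMatrix n) → ∀ i j → entℚ (embed A) i j ≡ ent A i j / 1
entℚ-embed A zero    j       = refl
entℚ-embed A (suc i) zero    = refl
entℚ-embed {n} A (suc i) (suc j) with i <? n | j <? n
... | yes _ | yes _ = refl
... | yes _ | no _  = refl
... | no _  | _     = refl

entℚ-toℕ : {n : ℕ} (M : QMatrix n) (a b : Fin n) → entℚ M (suc (toℕ a)) (suc (toℕ b)) ≡ M a b
entℚ-toℕ {n} M a b with toℕ a <? n | toℕ b <? n
... | yes a<n | yes b<n = cong₂ M (FinP.fromℕ<-toℕ a a<n) (FinP.fromℕ<-toℕ b b<n)
... | yes _   | no b≮n  = ⊥-elim (b≮n (FinP.toℕ<n b))
... | no a≮n  | _       = ⊥-elim (a≮n (FinP.toℕ<n a))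

Sℚ : ℕ → (ℕ → ℚ) → ℚ
Sℚ zero    f = 0ℚ
Sℚ (suc k) f = Sℚ k f + f (suc k)

Sℚ-cong : ∀ k {f g} → (∀ x → f x ≡ g x) → Sℚ k f ≡ Sℚ k g
Sℚ-cong zero    f≗g = refl
Sℚ-cong (suc k) f≗g = cong₂ _+_ (Sℚ-cong k f≗g) (f≗g (suc k))

Sℚ-+ : ∀ k f g → Sℚ k (λ x → f x + g x) ≡ Sℚ k f + Sℚ k g
Sℚ-+ zero    f g = sym (ℚP.+-identityˡ 0ℚ)
Sℚ-+ (suc k) f g = trans (cong (_+ (f (suc k) + g (suc k))) (Sℚ-+ k f g))
  (interchange (Sℚ k f) (Sℚ k g) (f (suc k)) (g (suc k)))
  where
  interchange : ∀ a b c d → (a + b) + (c + d) ≡ (a + c) + (b + d)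
  interchange = solve-∀ ℚ-almostCommutativeRing

Sℚ-* : ∀ k c f → Sℚ k (λ x → c * f x) ≡ c * Sℚ k f
Sℚ-* zero    c f = sym (ℚP.*-zeroʳ c)
Sℚ-* (suc k) c f = trans (cong (_+ c * f (suc k)) (Sℚ-* k c f))
  (sym (ℚP.*-distribˡ-+ c (Sℚ k f) (f (suc k))))

Sℚ-0 : ∀ k → Sℚ k (λ _ → 0ℚ) ≡ 0ℚ
Sℚ-0 zero    = refl
Sℚ-0 (suc k) = trans (cong (_+ 0ℚ) (Sℚ-0 k)) (ℚP.+-identityʳ 0ℚ)

Sℚ-/1 : ∀ k h → Sℚ k (λ x → h x / 1) ≡ S k h / 1
Sℚ-/1 zero    h = refl
Sℚ-/1 (suc k) h = trans (cong (_+ h (suc k) / 1) (Sℚ-/1 k h)) (sym (/1-homo-+ (S k h) (h (suc k))))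

colSum : {n : ℕ} → QMatrix n → ℕ → ℕ → ℚ
colSum M k j = Sℚ k (λ i → entℚ M i j)

colSum-+ : {n : ℕ} (M N : QMatrix n) → ∀ k j → colSum (M +ᴹ N) k j ≡ colSum M k j + colSum N k j
colSum-+ M N k j = trans (Sℚ-cong k (λ i → entℚ-map₂ _+_ (ℚP.+-identityʳ 0ℚ) M N i j))
  (Sℚ-+ k (λ i → entℚ M i j) (λ i → entℚ N i j))

colSum-* : {n : ℕ} (c : ℚ) (M : QMatrix n) → ∀ k j → colSum (c ·ᴹ M) k j ≡ c * colSum M k j
colSum-* c M k j = trans (Sℚ-cong k (λ i → entℚ-map₂ (λ x _ → c * x) (ℚP.*-zeroʳ c) M M i j))
  (Sℚ-* k c (λ i → entℚ M i j))

colSum-zero : {n : ℕ} → ∀ k j → colSum (zeroᴹ {n}) k j ≡ 0ℚ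
colSum-zero {n} k j =
  trans (Sℚ-cong k (λ i → entℚ-map₂ (λ _ _ → 0ℚ) refl (zeroᴹ {n}) zeroᴹ i j)) (Sℚ-0 k)

colSum-cong : {n : ℕ} {M N : QMatrix n} → (∀ a b → M a b ≡ N a b) →
  ∀ k j → colSum M k j ≡ colSum N k j
colSum-cong M≗N k j = Sℚ-cong k (λ i → entℚ-cong M≗N i j)

colSum-embed : {n : ℕ} (A : ZMatrix n) → ∀ k j → colSum (embed A) k j ≡ S k (λ i → ent A i j) / 1
colSum-embed A k j = trans (Sℚ-cong k (λ i → entℚ-embed A i j)) (Sℚ-/1 k (λ i → ent A i j))

ℤ-unit-interval⇒0∨1 : ∀ {s} → ℤ.+ 0 ℤ.≤ s → s ℤ.≤ ℤ.+ 1 → s ≡ ℤ.+ 0 ⊎ s ≡ ℤ.+ 1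
ℤ-unit-interval⇒0∨1 {ℤ.+ 0}           _  _                  = inj₁ refl
ℤ-unit-interval⇒0∨1 {ℤ.+ 1}           _  _                  = inj₂ refl
ℤ-unit-interval⇒0∨1 {ℤ.+ suc (suc _)} _  (ℤ.+≤+ (s≤s ()))
ℤ-unit-interval⇒0∨1 { -[1+ _ ]}       ()  _

magog-colSum-Bit : {n : ℕ} {A : ZMatrix n} → IsMagog A → ∀ k j →
  1 ℕ.≤ k → k ℕ.≤ n → 1 ℕ.≤ j → j ℕ.≤ n → Bit (colSum (embed A) k j)
magog-colSum-Bit {A = A} m k j 1≤k k≤n 1≤j j≤n =
  let (0≤S , S≤1) = IsMagog.colPartial m k j 1≤k k≤n 1≤j j≤n
  in Sum.map viaEmbed viaEmbed (ℤ-unit-interval⇒0∨1 0≤S S≤1)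
  where
  viaEmbed : ∀ {c} → S k (λ i → ent A i j) ≡ c → colSum (embed A) k j ≡ c / 1
  viaEmbed S≡c = trans (colSum-embed A k j) (cong (_/ 1) S≡c)

colSum-combo-∷ : {n : ℕ} (t : ℚ) (A : ZMatrix n) (m : IsMagog A) (cs : List (Term n)) → ∀ k j →
  colSum (combo ((t , A , m) ∷ cs)) k j ≡ t * colSum (embed A) k j + colSum (combo cs) k j
colSum-combo-∷ t A m cs k j =
  trans (colSum-+ (t ·ᴹ embed A) (combo cs) k j)
        (cong (_+ colSum (combo cs) k j) (colSum-* t (embed A) k j))

colSum-combo-∈[0,coeffSum] : {n : ℕ} (cs : List (Term n)) → All NonNegCoeff cs → ∀ k j →
  1 ℕ.≤ k → k ℕ.≤ n → 1 ℕ.≤ j → j ℕ.≤ n → colSum (combo cs) k j ∈[0, coeffSum cs ]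
colSum-combo-∈[0,coeffSum] [] [] k j _ _ _ _ =
  ℚP.≤-reflexive (sym (colSum-zero k j)) , ℚP.≤-reflexive (colSum-zero k j)
colSum-combo-∈[0,coeffSum] ((t , A , m) ∷ cs) (0≤t ∷ 0≤cs) k j 1≤k k≤n 1≤j j≤n =
  subst (_∈[0, t + coeffSum cs ]) (sym (colSum-combo-∷ t A m cs k j))
    (+-∈[0,u+v] (*-∈[0,t] 0≤t (Bit⇒∈[0,1] (magog-colSum-Bit m k j 1≤k k≤n 1≤j j≤n)))
              (colSum-combo-∈[0,coeffSum] cs 0≤cs k j 1≤k k≤n 1≤j j≤n))

∈TSSCPP⇒colSum∈[0,1] : {n : ℕ} {Y : QMatrix n} → InTSSCPP n Y → ∀ k j →
  1 ℕ.≤ k → k ℕ.≤ n → 1 ℕ.≤ j → j ℕ.≤ n → colSum Y k j ∈[0, 1ℚ ]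
∈TSSCPP⇒colSum∈[0,1] (cs , 0≤cs , cs≡1 , Y≗combo) k j 1≤k k≤n 1≤j j≤n =
  subst (_∈[0, 1ℚ ]) (sym (colSum-cong Y≗combo k j))
    (subst (λ u → colSum (combo cs) k j ∈[0, u ]) cs≡1
      (colSum-combo-∈[0,coeffSum] cs 0≤cs k j 1≤k k≤n 1≤j j≤n))

colSum-convex : {n : ℕ} (t : ℚ) (Y Z : QMatrix n) → ∀ k j →
  colSum ((t ·ᴹ Y) +ᴹ ((1ℚ - t) ·ᴹ Z)) k j ≡ t * colSum Y k j + (1ℚ - t) * colSum Z k j
colSum-convex t Y Z k j = trans (colSum-+ (t ·ᴹ Y) ((1ℚ - t) ·ᴹ Z) k j)
  (cong₂ _+_ (colSum-* t Y k j) (colSum-* (1ℚ - t) Z k j))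

colSum-injective : {n : ℕ} {Y Z : QMatrix n} →
  (∀ k j → k ℕ.≤ n → 1 ℕ.≤ j → j ℕ.≤ n → colSum Y k j ≡ colSum Z k j) → ∀ a b → Y a b ≡ Z a b
colSum-injective {n} {Y} {Z} same a b = begin
  Y a b                  ≡⟨ entℚ-toℕ Y a b ⟨
  entℚ Y (suc a′) (suc b′) ≡⟨ +-cancelˡ (colSum Y a′ (suc b′)) _ _ consecutive ⟩
  entℚ Z (suc a′) (suc b′) ≡⟨ entℚ-toℕ Z a b ⟩
  Z a b                  ∎
  where
  open ≡-Reasoning
  a′ = toℕ a
  b′ = toℕ b
  consecutive : colSum Y (suc a′) (suc b′) ≡ colSum Y a′ (suc b′) + entℚ Z (suc a′) (suc b′)
  consecutive = trans (same (suc a′) (suc b′) (FinP.toℕ<n a) (s≤s z≤n) (FinP.toℕ<n b))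
    (cong (_+ entℚ Z (suc a′) (suc b′))
      (sym (same a′ (suc b′) (ℕP.<⇒≤ (FinP.toℕ<n a)) (s≤s z≤n) (FinP.toℕ<n b))))

Extreme : (n : ℕ) → QMatrix n → Set
Extreme n X = ∀ (Y Z : QMatrix n) (t : ℚ) → InTSSCPP n Y → InTSSCPP n Z →
  0ℚ < t → t < 1ℚ → (∀ i j → X i j ≡ ((t ·ᴹ Y) +ᴹ ((1ℚ - t) ·ᴹ Z)) i j) →
  ∀ i j → Y i j ≡ Z i j

magogQ∈TSSCPP : {n : ℕ} {X : QMatrix n} → IsMagogQ n X → InTSSCPP n X
magogQ∈TSSCPP (A , m , X≗A) =
  ((1ℚ , A , m) ∷ []) , ℚP.nonNegative⁻¹ 1ℚ ∷ [] , ℚP.+-identityʳ 1ℚ ,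
  λ a b → trans (X≗A a b) (sym (trans (ℚP.+-identityʳ _) (ℚP.*-identityˡ _)))

magogQ-extreme : {n : ℕ} {X : QMatrix n} → IsMagogQ n X → Extreme n X
magogQ-extreme {n} {X} (A , m , X≗A) Y Z t Y∈ Z∈ 0<t t<1 X≗tY+[1-t]Z =
  colSum-injective sameColSum
  where
  A≗tY+[1-t]Z : ∀ a b → embed A a b ≡ ((t ·ᴹ Y) +ᴹ ((1ℚ - t) ·ᴹ Z)) a b
  A≗tY+[1-t]Z a b = trans (sym (X≗A a b)) (X≗tY+[1-t]Z a b)
  sameColSum : ∀ k j → k ℕ.≤ n → 1 ℕ.≤ j → j ℕ.≤ n → colSum Y k j ≡ colSum Z k j
  sameColSum zero    j _   _   _   = refl
  sameColSum (suc k) j k<n 1≤j j≤n =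
    Bit-convex⇒≡ (magog-colSum-Bit m (suc k) j (s≤s z≤n) k<n 1≤j j≤n) 0<t t<1
      (∈TSSCPP⇒colSum∈[0,1] Y∈ (suc k) j (s≤s z≤n) k<n 1≤j j≤n)
      (∈TSSCPP⇒colSum∈[0,1] Z∈ (suc k) j (s≤s z≤n) k<n 1≤j j≤n)
      (begin
        colSum (embed A) (suc k) j                             ≡⟨ colSum-cong A≗tY+[1-t]Z (suc k) j ⟩
        colSum ((t ·ᴹ Y) +ᴹ ((1ℚ - t) ·ᴹ Z)) (suc k) j         ≡⟨ colSum-convex t Y Z (suc k) j ⟩
        t * colSum Y (suc k) j + (1ℚ - t) * colSum Z (suc k) j ∎)
    where open ≡-Reasoning

coeffSum-nonNeg : {n : ℕ} {cs : List (Term n)} → All NonNegCoeff cs → 0ℚ ≤ coeffSum cs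
coeffSum-nonNeg []            = ℚP.≤-refl
coeffSum-nonNeg (0≤t ∷ 0≤cs) = +-nonNeg 0≤t (coeffSum-nonNeg 0≤cs)

combo-∷-zeroCoeff : {n : ℕ} {t : ℚ} (A : ZMatrix n) (m : IsMagog A) (cs : List (Term n)) →
  t ≡ 0ℚ → ∀ a b → combo ((t , A , m) ∷ cs) a b ≡ combo cs a b
combo-∷-zeroCoeff A m cs refl a b =
  trans (cong (_+ combo cs a b) (ℚP.*-zeroˡ (embed A a b))) (ℚP.+-identityˡ _)

combo-coeffSum≡0 : {n : ℕ} (cs : List (Term n)) → All NonNegCoeff cs → coeffSum cs ≡ 0ℚ →
  ∀ a b → combo cs a b ≡ 0ℚ
combo-coeffSum≡0 []                  []            _     a b = refl
combo-coeffSum≡0 ((t , A , m) ∷ cs) (0≤t ∷ 0≤cs) sum≡0 a b =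
  trans (combo-∷-zeroCoeff A m cs (p+q≡0⇒p≡0 0≤t 0≤s sum≡0) a b)
        (combo-coeffSum≡0 cs 0≤cs (p+q≡0⇒q≡0 0≤t 0≤s sum≡0) a b)
  where 0≤s = coeffSum-nonNeg 0≤cs

rescale : {n : ℕ} → ℚ → List (Term n) → List (Term n)
rescale r = map (λ (c , A) → (c * r , A))

coeffSum-rescale : {n : ℕ} (r : ℚ) (cs : List (Term n)) → coeffSum (rescale r cs) ≡ coeffSum cs * r
coeffSum-rescale r []            = sym (ℚP.*-zeroˡ r)
coeffSum-rescale r ((c , _) ∷ cs) =
  trans (cong ((c * r) +_) (coeffSum-rescale r cs)) (sym (ℚP.*-distribʳ-+ r c (coeffSum cs)))

combo-rescale : {n : ℕ} (r : ℚ) (cs : List (Term n)) →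
  ∀ a b → combo (rescale r cs) a b ≡ r * combo cs a b
combo-rescale r []                  a b = sym (ℚP.*-zeroʳ r)
combo-rescale r ((c , A , _) ∷ cs) a b =
  trans (cong ((c * r) * embed A a b +_) (combo-rescale r cs a b))
    (rearrange c r (embed A a b) (combo cs a b))
  where
  rearrange : ∀ c r e z → (c * r) * e + r * z ≡ r * (c * e + z)
  rearrange = solve-∀ ℚ-almostCommutativeRing

rescale-∈TSSCPP : {n : ℕ} (r : ℚ) (cs : List (Term n)) → All NonNegCoeff cs →
  0ℚ ≤ r → coeffSum cs * r ≡ 1ℚ → InTSSCPP n (r ·ᴹ combo cs)
rescale-∈TSSCPP r cs 0≤cs 0≤r cs*r≡1 =
  rescale r cs , gmap⁺ (λ 0≤c → *-nonNeg 0≤c 0≤r) 0≤cs ,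
  trans (coeffSum-rescale r cs) cs*r≡1 , λ a b → sym (combo-rescale r cs a b)

combo-∷-convex : {n : ℕ} (t : ℚ) (A : ZMatrix n) (m : IsMagog A) (cs : List (Term n)) →
  All NonNegCoeff cs → 0ℚ < coeffSum cs → t + coeffSum cs ≡ 1ℚ →
  Σ[ Z ∈ QMatrix n ] InTSSCPP n Z ×
    (∀ a b → combo ((t , A , m) ∷ cs) a b ≡ t * embed A a b + (1ℚ - t) * Z a b)
combo-∷-convex {n} t A m cs 0≤cs 0<s t+s≡1 =
  (1/ s) ·ᴹ combo cs ,
  rescale-∈TSSCPP (1/ s) cs 0≤cs 0≤1/s (ℚP.*-inverseʳ s) ,
  λ a b → cong (t * embed A a b +_) (begin
    combo cs a b                        ≡⟨ ℚP.*-identityˡ _ ⟨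
    1ℚ * combo cs a b                   ≡⟨ cong (_* combo cs a b) (ℚP.*-inverseʳ s) ⟨
    (s * 1/ s) * combo cs a b           ≡⟨ ℚP.*-assoc s (1/ s) _ ⟩
    s * (1/ s * combo cs a b)           ≡⟨ cong (_* (1/ s * combo cs a b)) 1-t≡s ⟨
    (1ℚ - t) * (1/ s * combo cs a b)    ∎)
  where
  open ≡-Reasoning
  s = coeffSum cs
  instance
    s-positive = ℚ.positive 0<s
    s-nonZero = ℚP.pos⇒nonZero s
  0≤1/s : 0ℚ ≤ 1/ s
  0≤1/s = ℚP.<⇒≤ (ℚP.positive⁻¹ (1/ s) {{ℚP.1/pos⇒pos s}})
  1-t≡s : 1ℚ - t ≡ s
  1-t≡s = trans (cong (_- t) (sym t+s≡1)) (cancel t s)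
    where
    cancel : ∀ t s → (t + s) - t ≡ s
    cancel = solve-∀ ℚ-almostCommutativeRing

extreme-combo⇒magogQ : {n : ℕ} {X : QMatrix n} (cs : List (Term n)) → All NonNegCoeff cs →
  coeffSum cs ≡ 1ℚ → (∀ a b → X a b ≡ combo cs a b) → Extreme n X → IsMagogQ n X
extreme-combo⇒magogQ [] [] () _ _
extreme-combo⇒magogQ {n} {X} ((t , A , m) ∷ cs) (0≤t ∷ 0≤cs) t+s≡1 X≗combo X-extreme
  with t ℚP.≤? 0ℚ | coeffSum cs ℚP.≤? 0ℚ
... | yes t≤0 | _ = extreme-combo⇒magogQ cs 0≤cs s≡1 X≗tail X-extreme
  where
  t≡0 = ℚP.≤-antisym t≤0 0≤t
  s≡1 = trans (sym (ℚP.+-identityˡ _)) (trans (cong (_+ coeffSum cs) (sym t≡0)) t+s≡1)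
  X≗tail : ∀ a b → X a b ≡ combo cs a b
  X≗tail a b = trans (X≗combo a b) (combo-∷-zeroCoeff A m cs t≡0 a b)
... | no _ | yes s≤0 = A , m , X≗A
  where
  s≡0 = ℚP.≤-antisym s≤0 (coeffSum-nonNeg 0≤cs)
  t≡1 = trans (sym (ℚP.+-identityʳ t)) (trans (cong (t +_) (sym s≡0)) t+s≡1)
  X≗A : ∀ a b → X a b ≡ embed A a b
  X≗A a b = trans (X≗combo a b)
    (trans (cong₂ (λ u v → u * embed A a b + v) t≡1 (combo-coeffSum≡0 cs 0≤cs s≡0 a b))
      (trans (ℚP.+-identityʳ _) (ℚP.*-identityˡ _)))
... | no t≰0 | no s≰0 =
  let (Z , Z∈ , combo≗tA+[1-t]Z) = combo-∷-convex t A m cs 0≤cs 0<s t+s≡1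
      A≗Z = X-extreme (embed A) Z t (magogQ∈TSSCPP (A , m , λ _ _ → refl)) Z∈ 0<t t<1
              (λ a b → trans (X≗combo a b) (combo≗tA+[1-t]Z a b))
  in A , m , λ a b → begin
    X a b                                    ≡⟨ X≗combo a b ⟩
    combo ((t , A , m) ∷ cs) a b             ≡⟨ combo≗tA+[1-t]Z a b ⟩
    t * embed A a b + (1ℚ - t) * Z a b       ≡⟨ cong (λ z → t * embed A a b + (1ℚ - t) * z) (A≗Z a b) ⟨
    t * embed A a b + (1ℚ - t) * embed A a b ≡⟨ convex-idem t (embed A a b) ⟩
    embed A a b                              ∎
  where
  open ≡-Reasoning
  0<s = ℚP.≰⇒> s≰0
  0<t = ℚP.≰⇒> t≰0
  t<1 : t < 1ℚ
  t<1 = subst₂ _<_ (ℚP.+-identityʳ t) t+s≡1 (ℚP.+-monoʳ-< t 0<s)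
  convex-idem : ∀ t e → t * e + (1ℚ - t) * e ≡ e
  convex-idem = solve-∀ ℚ-almostCommutativeRing

theorem4p7 : (n : ℕ) → 1 ℕ.≤ n → (X : QMatrix n) →
    (IsVertex n X → IsMagogQ n X) × (IsMagogQ n X → IsVertex n X)
theorem4p7 n _ X =
  (λ ((cs , 0≤cs , cs≡1 , X≗combo) , X-extreme) →
     extreme-combo⇒magogQ cs 0≤cs cs≡1 X≗combo X-extreme) ,
  (λ X-magog → magogQ∈TSSCPP X-magog , magogQ-extreme X-magog)
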